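{- In the setting described in the context, let $v_1,\dots,v_6$ be vertices of $H$ building an $AP_6$ with $\ell_{v_2v_3}=\ell_1$, $\ell_{v_4v_5}=\ell_2$, $\ell_{v_6v_1}=\ell_3$, and suppose $(\ell_1\vee\ell_2\vee\ell_3)$ is a clause of $\phi_1$. Then for every edge $e$ of $H$ with $\ell_e=\ell_2$ there exist vertices $w_1,\dots,w_6$ of $H$ building an $AP_6$ such that $\{w_1,w_2\}=\{v_1,v_2\}$ (its base), $w_4w_5=e$ (its ceiling), and $\ell_{w_2w_3}=\ell_1$, $\ell_{w_4w_5}=\ell_2$, $\ell_{w_6w_1}=\ell_3$.
   Context: Let $G$ be a cocomparability graph with $n$ vertices and $P$ a (strict) partial order whose comparability graph is $\overline{G}$; ground set $U=\{u_1,\dots,u_n\}$, and $V=\{v'_1,\dots,v'_n\}$ disjoint. Let $\widetilde{E}=\{u_iv'_j: u_i<_Pu_j\text{ does not hold}\}$ and let $H$ be the graph on $U\cup V$ with edge set $E_H=\widetilde{E}\cup\{vv':v,v'\in V,v\ne v'\}$. Alternating cycles: in a graph $(W,E)$, vertices $w_1,\dots,w_{2k}$, $k\ge2$ (not necessarily distinct, but $w_i\ne w_{i+1}$, indices mod $2k$) build an $AC_{2k}$ in $F\subseteq E$ if $w_iw_{i+1}\in F$ for even $i$ and $w_iw_{i+1}\notin E$ for odd $i$; its edges are the $w_iw_{i+1}$, $i$ even. An $AP_6$ is an $AC_6$ (in $E$) on six distinct vertices $w_1,\dots,w_6$; the non-edge $w_1w_2$ is a base of it with corresponding ceiling the edge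 $w_4w_5$. Edges $e_1,e_2$ are in conflict if one can write $e_1=ab$, $e_2=cd$ with $a,b,c,d$ distinct and $ad,bc\notin E$. The conflict graph $H^*$ has vertex set $E_H$, two edges adjacent iff in conflict in $H$. Assume $H^*$ is bipartite, fix a proper 2-colouring $\chi_0$ (red/blue) of $H^*$, let $C_1,\dots,C_k$ be its connected components with a boolean variable $x_i$ for $C_i$; for an edge $e$ in $C_i$, $\ell_e=x_i$ if red in $\chi_0$ and $\ell_e=\overline{x_i}$ if blue. $\phi_1$ is the conjunction, over all triples $\{e,e',e''\}$ of edges of $H$ that are the three edges of some $AC_6$ in $E_H$ and such that no two of $\ell_e,\ell_{e'},\ell_{e''}$ are negations of each other, of the clauses $(\ell_e\vee\ell_{e'}\vee\ell_{e''})$ and $(\overline{\ell_e}\vee\overline{\ell_{e'}}\vee\overline{\ell_{e''}})$. -}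

module Defs where

open import Level using (0ℓ)
open import Data.Nat using (ℕ)
open import Data.Fin using (Fin)
open import Data.Bool using (Bool; true; false; not)
open import Data.Sum using (_⊎_; inj₁; inj₂)
open import Data.Product using (Σ; ∃; _×_; _,_)
open import Data.Empty using (⊥)
open import Relation.Nullary using (¬_)
open import Relation.Binary using (Rel)
open import Relation.Binary.PropositionalEquality using (_≡_; _≢_)
open import Function.Bundles using (_⇔_)

-- The graph H built from a (strict) partial order P on the ground set
-- U = {u_1..u_n} (encoded as inj₁ i) together with the disjoint copy
-- V = {v'_1..v'_n} (encoded as inj₂ j).
module Graph {n : ℕ} (_<P_ : Rel (Fin n) 0ℓ) where

  Vtx : Set
  Vtx = Fin n ⊎ Fin n

  Adj : Vtx → Vtx → Set
  Adj (inj₁ i) (inj₂ j) = ¬ (i <P j)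
  Adj (inj₂ j) (inj₁ i) = ¬ (i <P j)
  Adj (inj₁ _) (inj₁ _) = ⊥
  Adj (inj₂ j) (inj₂ j') = ¬ (j ≡ j')

  -- an edge of H, given by an (arbitrarily) oriented pair of endpoints
  record Edge : Set where
    constructor mkE
    field
      src : Vtx
      tgt : Vtx
      adj : Adj src tgt

  SameEdge : Edge → Edge → Set
  SameEdge (mkE a b _) (mkE c d _) = (a ≡ c × b ≡ d) ⊎ (a ≡ d × b ≡ c)

  NonEdge : Vtx → Vtx → Set
  NonEdge a b = a ≢ b × ¬ Adj a b

  Distinct4 : Vtx → Vtx → Vtx → Vtx → Set
  Distinct4 a b c d = a ≢ b × a ≢ c × a ≢ d × b ≢ c × b ≢ d × c ≢ d

  ConflictOriented : Vtx → Vtx → Vtx → Vtx → Set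
  ConflictOriented a b c d = Distinct4 a b c d × ¬ Adj a d × ¬ Adj b c

  Conflict : Edge → Edge → Set
  Conflict (mkE a b _) (mkE c d _) =
    ConflictOriented a b c d ⊎ ConflictOriented a b d c ⊎
    ConflictOriented b a c d ⊎ ConflictOriented b a d c

  data Conn : Edge → Edge → Set where
    base : ∀ {e f} → SameEdge e f → Conn e f
    step : ∀ {e f g} → Conn e f → Conflict f g → Conn e g

  record AC6 (w1 w2 w3 w4 w5 w6 : Vtx) : Set where
    field
      e23 : Adj w2 w3
      e45 : Adj w4 w5
      e61 : Adj w6 w1
      n12 : NonEdge w1 w2
      n34 : NonEdge w3 w4
      n56 : NonEdge w5 w6

  AllDistinct6 : Vtx → Vtx → Vtx → Vtx → Vtx → Vtx → Set
  AllDistinct6 w1 w2 w3 w4 w5 w6 =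
    w1 ≢ w2 × w1 ≢ w3 × w1 ≢ w4 × w1 ≢ w5 × w1 ≢ w6 ×
    w2 ≢ w3 × w2 ≢ w4 × w2 ≢ w5 × w2 ≢ w6 ×
    w3 ≢ w4 × w3 ≢ w5 × w3 ≢ w6 ×
    w4 ≢ w5 × w4 ≢ w6 ×
    w5 ≢ w6

  record AP6 (w1 w2 w3 w4 w5 w6 : Vtx) : Set where
    field
      cyc : AC6 w1 w2 w3 w4 w5 w6
      distinct : AllDistinct6 w1 w2 w3 w4 w5 w6

  edge23 : ∀ {w1 w2 w3 w4 w5 w6} → AC6 w1 w2 w3 w4 w5 w6 → Edge
  edge23 {w2 = w2} {w3 = w3} c = mkE w2 w3 (AC6.e23 c)
  edge45 : ∀ {w1 w2 w3 w4 w5 w6} → AC6 w1 w2 w3 w4 w5 w6 → Edge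
  edge45 {w4 = w4} {w5 = w5} c = mkE w4 w5 (AC6.e45 c)
  edge61 : ∀ {w1 w2 w3 w4 w5 w6} → AC6 w1 w2 w3 w4 w5 w6 → Edge
  edge61 {w1 = w1} {w6 = w6} c = mkE w6 w1 (AC6.e61 c)

  -- χ0 (true = red, false = blue) is a proper 2-colouring of H*
  ProperColouring : (Edge → Bool) → Set
  ProperColouring χ = ∀ e f → Conflict e f → χ e ≢ χ f

  WellDefinedColouring : (Edge → Bool) → Set
  WellDefinedColouring χ = ∀ e f → SameEdge e f → χ e ≡ χ f

  IsComponentLabelling : (k : ℕ) → (Edge → Fin k) → Set
  IsComponentLabelling k comp =
    (∀ e f → (comp e ≡ comp f ⇔ Conn e f)) × (∀ i → ∃ λ e → comp e ≡ i)

  -- literals over the variables x_1..x_k: (i , true) = x_i, (i , false) = ¬x_i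
  Lit : ℕ → Set
  Lit k = Fin k × Bool

  neg : ∀ {k} → Lit k → Lit k
  neg (i , b) = i , not b

  -- a clause with three literals (its meaning is the set of its literals)
  Clause : ℕ → Set
  Clause k = Lit k × Lit k × Lit k

  _∈C_ : ∀ {k} → Lit k → Clause k → Set
  l ∈C (a , b , c) = l ≡ a ⊎ l ≡ b ⊎ l ≡ c

  SameClause : ∀ {k} → Clause k → Clause k → Set
  SameClause C D = ∀ l → (l ∈C C ⇔ l ∈C D)

  module Literals {k : ℕ} (χ0 : Edge → Bool) (comp : Edge → Fin k) where

    ℓ : Edge → Lit k
    ℓ e = comp e , χ0 e

    InPhi1 : Clause k → Set
    InPhi1 C =
      Σ Vtx λ w1 → Σ Vtx λ w2 → Σ Vtx λ w3 → Σ Vtx λ w4 → Σ Vtx λ w5 → Σ Vtx λ w6 →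
      Σ (AC6 w1 w2 w3 w4 w5 w6) λ c →
        let a = ℓ (edge23 c) ; b = ℓ (edge45 c) ; d = ℓ (edge61 c) in
        (a ≢ neg b × a ≢ neg d × b ≢ neg d) ×
        (SameClause C (a , b , d) ⊎ SameClause C (neg a , neg b , neg d))

-- Let ab be an edge in conflict with the ceiling v4v5 of an AP_6 v1 … v6 whose three literals
-- are pairwise non-complementary, written so that v4a and v5b are non-edges. Then v2 v1 v4 a b v5
-- is again an AP_6 with the same base: v1v4 and v2v5 must be edges, since otherwise v4v5 would
-- be in conflict with v6v1 or v2v3 and two literals of the clause would be complementary; and
-- each edge of the new cycle is in conflict with the edge in the same position of the old one,
-- so all three literals are negated. Walking along a path of conflicts from the ceiling to e
-- (both lie in one component of H*, as ℓ e = ℓ₂) yields an AP_6 with ceiling e whose literals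
-- are those of the original or all negated; ℓ e = ℓ₂ excludes the latter.
--
-- The new vertices a, b avoid v1, v2 because U is independent and V is a clique in H; this shape
-- of H is all that is used, never the order axioms of P.
module Submission where

open import Defs
open import Level using (0ℓ)
open import Data.Nat using (ℕ)
open import Data.Fin using (Fin)
open import Data.Bool using (Bool)
open import Data.Bool.Properties using (not-involutive; not-¬; ¬-not)
open import Data.Sum using (_⊎_; inj₁; inj₂)
open import Data.Product using (Σ; _×_; _,_; proj₁; proj₂)
open import Data.Empty using (⊥-elim)
open import Function using (_∘_)
open import Function.Bundles using (Equivalence)
open import Relation.Nullary using (¬_)
open import Relation.Binary using (Rel; IsStrictPartialOrder)
open import Relation.Binary.PropositionalEquality
  using (_≡_; _≢_; ≢-sym; refl; sym; trans; cong; cong₂; subst; module ≡-Reasoning)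

data Side : Set where
  U V : Side

module Properties {n : ℕ} (_<P_ : Rel (Fin n) 0ℓ) where
  open Graph _<P_

  Adj-sym : ∀ {x y} → Adj x y → Adj y x
  Adj-sym {inj₁ _} {inj₂ _} p = p
  Adj-sym {inj₂ _} {inj₁ _} p = p
  Adj-sym {inj₂ _} {inj₂ _} p = p ∘ sym

  Adj-stable : ∀ x y → ¬ ¬ Adj x y → Adj x y
  Adj-stable (inj₁ _) (inj₂ _) ¬¬p i<j = ¬¬p (λ p → p i<j)
  Adj-stable (inj₂ _) (inj₁ _) ¬¬p i<j = ¬¬p (λ p → p i<j)
  Adj-stable (inj₂ _) (inj₂ _) ¬¬p j≡j′ = ¬¬p (λ p → p j≡j′)
  Adj-stable (inj₁ _) (inj₁ _) ¬¬p = ¬¬p (λ ())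

  NonEdge-sym : ∀ {x y} → NonEdge x y → NonEdge y x
  NonEdge-sym (x≢y , ¬p) = ≢-sym x≢y , ¬p ∘ Adj-sym

  side : Vtx → Side
  side (inj₁ _) = U
  side (inj₂ _) = V

  Adj-U⇒V : ∀ {x y} → Adj x y → side x ≡ U → side y ≡ V
  Adj-U⇒V {inj₁ _} {inj₂ _} _ _ = refl
  Adj-U⇒V {inj₂ _} _ ()

  NonEdge-V⇒U : ∀ {x y} → NonEdge x y → side x ≡ V → side y ≡ U
  NonEdge-V⇒U {inj₂ _} {inj₁ _} _ _ = refl
  NonEdge-V⇒U {inj₂ _} {inj₂ _} (x≢y , ¬p) _ = ⊥-elim (¬p (x≢y ∘ cong inj₂))
  NonEdge-V⇒U {inj₁ _} _ ()

  U≢V : ∀ {x y} → side x ≡ U → side y ≡ V → x ≢ y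
  U≢V {inj₁ _} {inj₂ _} _ _ ()
  U≢V {inj₁ _} {inj₁ _} _ ()
  U≢V {inj₂ _} ()

  AC6-sides : ∀ {w1 w2 w3 w4 w5 w6} → AC6 w1 w2 w3 w4 w5 w6 →
    (side w1 ≡ U × side w2 ≡ V × side w4 ≡ V) ⊎ (side w1 ≡ V × side w2 ≡ U × side w5 ≡ V)
  AC6-sides {inj₁ _} {w2} {w3} {w4} {w5} {w6} c = inj₁ (refl , V₂ , V₄)
    where
      open AC6 c
      V₆ : side w6 ≡ V
      V₆ = Adj-U⇒V (Adj-sym e61) refl
      V₄ : side w4 ≡ V
      V₄ = Adj-U⇒V (Adj-sym e45) (NonEdge-V⇒U (NonEdge-sym n56) V₆)
      V₂ : side w2 ≡ V
      V₂ = Adj-U⇒V (Adj-sym e23) (NonEdge-V⇒U (NonEdge-sym n34) V₄)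
  AC6-sides {inj₂ _} {w2} {w3} {w4} {w5} c = inj₂ (refl , U₂ , V₅)
    where
      open AC6 c
      U₂ : side w2 ≡ U
      U₂ = NonEdge-V⇒U n12 refl
      V₅ : side w5 ≡ V
      V₅ = Adj-U⇒V e45 (NonEdge-V⇒U n34 (Adj-U⇒V e23 U₂))

  swapped-ceiling-avoids-base : ∀ {w1 w2 w3 w4 w5 w6 α β} → AC6 w1 w2 w3 w4 w5 w6 →
    NonEdge w4 α → Adj α β → NonEdge w5 β → w2 ≢ α × w1 ≢ β
  swapped-ceiling-avoids-base {α = α} {β} c n4α aαβ n5β with AC6-sides c
  ... | inj₁ (U₁ , V₂ , V₄) = ≢-sym (U≢V Uα V₂) , U≢V U₁ (Adj-U⇒V aαβ Uα)
    where
      Uα : side α ≡ U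
      Uα = NonEdge-V⇒U n4α V₄
  ... | inj₂ (V₁ , U₂ , V₅) = U≢V U₂ (Adj-U⇒V (Adj-sym aαβ) Uβ) , ≢-sym (U≢V Uβ V₁)
    where
      Uβ : side β ≡ U
      Uβ = NonEdge-V⇒U n5β V₅

  SamePair : Vtx → Vtx → Vtx → Vtx → Set
  SamePair a b c d = (a ≡ c × b ≡ d) ⊎ (a ≡ d × b ≡ c)

  SamePair-swap : ∀ {a b c d} → SamePair a b c d → SamePair b a c d
  SamePair-swap (inj₁ (a≡c , b≡d)) = inj₂ (b≡d , a≡c)
  SamePair-swap (inj₂ (a≡d , b≡c)) = inj₁ (b≡c , a≡d)

  SameEdge-refl : ∀ e → SameEdge e e
  SameEdge-refl (mkE _ _ _) = inj₁ (refl , refl)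

  SameEdge-conflict : ∀ e e′ g → SameEdge e e′ → Conflict e′ g → Conflict e g
  SameEdge-conflict (mkE _ _ _) (mkE _ _ _) (mkE _ _ _) (inj₁ (refl , refl)) cf = cf
  SameEdge-conflict (mkE _ _ _) (mkE _ _ _) (mkE _ _ _) (inj₂ (refl , refl)) cf with cf
  ... | inj₁ co = inj₂ (inj₂ (inj₁ co))
  ... | inj₂ (inj₁ co) = inj₂ (inj₂ (inj₂ co))
  ... | inj₂ (inj₂ (inj₁ co)) = inj₁ co
  ... | inj₂ (inj₂ (inj₂ co)) = inj₂ (inj₁ co)

  ConflictOriented-swap : ∀ {a b c d} → ConflictOriented a b c d → ConflictOriented b a d c
  ConflictOriented-swap ((a≢b , a≢c , a≢d , b≢c , b≢d , c≢d) , ¬ad , ¬bc) =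
    (≢-sym a≢b , b≢d , b≢c , a≢d , a≢c , ≢-sym c≢d) , ¬bc , ¬ad

  Conflict⇒oriented : ∀ {a b} (p : Adj a b) g → Conflict (mkE a b p) g →
    Σ Vtx λ α → Σ Vtx λ β → Σ (Adj α β) λ r →
      SameEdge (mkE α β r) g × ConflictOriented a b β α
  Conflict⇒oriented _ (mkE c d q) (inj₁ co) = d , c , Adj-sym q , inj₂ (refl , refl) , co
  Conflict⇒oriented _ (mkE c d q) (inj₂ (inj₁ co)) = c , d , q , inj₁ (refl , refl) , co
  Conflict⇒oriented _ (mkE c d q) (inj₂ (inj₂ (inj₁ co))) =
    c , d , q , inj₁ (refl , refl) , ConflictOriented-swap co
  Conflict⇒oriented _ (mkE c d q) (inj₂ (inj₂ (inj₂ co))) =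
    d , c , Adj-sym q , inj₂ (refl , refl) , ConflictOriented-swap co

  swapped-distinct : ∀ {w1 w2 w3 w4 w5 w6 α β} → AllDistinct6 w1 w2 w3 w4 w5 w6 →
    Distinct4 w4 w5 β α → w1 ≢ α → w2 ≢ α → w1 ≢ β → w2 ≢ β → AllDistinct6 w2 w1 w4 α β w5
  swapped-distinct (d12 , _ , d14 , d15 , _ , _ , d24 , d25 , _) (d45 , d4β , d4α , d5β , d5α , dβα)
                   d1α d2α d1β d2β =
    ≢-sym d12 , d24 , d2α , d2β , d25 , d14 , d1α , d1β , d15 , d4α , d4β , d45 , ≢-sym dβα ,
    ≢-sym d5α , ≢-sym d5β

  neg-involutive : ∀ {k} (l : Lit k) → neg (neg l) ≡ l
  neg-involutive (i , b) = cong (i ,_) (not-involutive b)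

  neg-injective : ∀ {k} {l m : Lit k} → neg l ≡ neg m → l ≡ m
  neg-injective {l = l} {m} eq =
    trans (sym (neg-involutive l)) (trans (cong neg eq) (neg-involutive m))

  neg-swap : ∀ {k} {l m : Lit k} → l ≡ neg m → m ≡ neg l
  neg-swap {m = m} refl = sym (neg-involutive m)

  l≢neg-l : ∀ {k} (l : Lit k) → l ≢ neg l
  l≢neg-l (_ , b) = not-¬ refl ∘ cong proj₂

  negClause : ∀ {k} → Clause k → Clause k
  negClause (a , b , d) = neg a , neg b , neg d

  negClause-involutive : ∀ {k} (C : Clause k) → negClause (negClause C) ≡ C
  negClause-involutive (a , b , d) =
    cong₂ _,_ (neg-involutive a) (cong₂ _,_ (neg-involutive b) (neg-involutive d))

  ∈C-negClause : ∀ {k} {C : Clause k} {l} → l ∈C negClause C → Σ (Lit k) λ m → m ∈C C × l ≡ neg m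
  ∈C-negClause {C = a , _ , _} (inj₁ refl) = a , inj₁ refl , refl
  ∈C-negClause {C = _ , b , _} (inj₂ (inj₁ refl)) = b , inj₂ (inj₁ refl) , refl
  ∈C-negClause {C = _ , _ , d} (inj₂ (inj₂ refl)) = d , inj₂ (inj₂ refl) , refl

  NonTautological : ∀ {k} → Clause k → Set
  NonTautological C = ∀ {l m} → l ∈C C → m ∈C C → l ≢ neg m

  NonTautological-intro : ∀ {k} {a b d : Lit k} →
    a ≢ neg b × a ≢ neg d × b ≢ neg d → NonTautological (a , b , d)
  NonTautological-intro {a = a} _ (inj₁ refl) (inj₁ refl) = l≢neg-l a
  NonTautological-intro (ab , _ , _) (inj₁ refl) (inj₂ (inj₁ refl)) = ab
  NonTautological-intro (_ , ad , _) (inj₁ refl) (inj₂ (inj₂ refl)) = ad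
  NonTautological-intro (ab , _ , _) (inj₂ (inj₁ refl)) (inj₁ refl) = ab ∘ neg-swap
  NonTautological-intro {b = b} _ (inj₂ (inj₁ refl)) (inj₂ (inj₁ refl)) = l≢neg-l b
  NonTautological-intro (_ , _ , bd) (inj₂ (inj₁ refl)) (inj₂ (inj₂ refl)) = bd
  NonTautological-intro (_ , ad , _) (inj₂ (inj₂ refl)) (inj₁ refl) = ad ∘ neg-swap
  NonTautological-intro (_ , _ , bd) (inj₂ (inj₂ refl)) (inj₂ (inj₁ refl)) = bd ∘ neg-swap
  NonTautological-intro {d = d} _ (inj₂ (inj₂ refl)) (inj₂ (inj₂ refl)) = l≢neg-l d

  NonTautological-negClause : ∀ {k} {C : Clause k} →
    NonTautological C → NonTautological (negClause C)
  NonTautological-negClause nt l∈ m∈ l≡¬m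
    with ∈C-negClause l∈ | ∈C-negClause m∈
  ... | _ , l′∈ , refl | _ , m′∈ , refl = nt l′∈ m′∈ (neg-injective l≡¬m)

  NonTautological-resp-SameClause : ∀ {k} {C D : Clause k} →
    SameClause C D → NonTautological D → NonTautological C
  NonTautological-resp-SameClause C≈D nt l∈ m∈ =
    nt (Equivalence.to (C≈D _) l∈) (Equivalence.to (C≈D _) m∈)

  _≡±_ : ∀ {k} → Clause k → Clause k → Set
  C ≡± D = C ≡ D ⊎ C ≡ negClause D

  ≡±-negClause : ∀ {k} {C C′ D : Clause k} → C′ ≡ negClause C → C ≡± D → C′ ≡± D
  ≡±-negClause C′≡¬C (inj₁ refl) = inj₂ C′≡¬C
  ≡±-negClause {D = D} C′≡¬C (inj₂ refl) = inj₁ (trans C′≡¬C (negClause-involutive D))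

  NonTautological-resp-≡± : ∀ {k} {C D : Clause k} → C ≡± D → NonTautological D → NonTautological C
  NonTautological-resp-≡± (inj₁ refl) nt = nt
  NonTautological-resp-≡± (inj₂ refl) nt = NonTautological-negClause nt

  InPhi1⇒NonTautological : ∀ {k} {χ0 : Edge → Bool} {comp : Edge → Fin k} {C} →
    Literals.InPhi1 χ0 comp C → NonTautological C
  InPhi1⇒NonTautological (_ , _ , _ , _ , _ , _ , _ , noComplements , inj₁ C≈D) =
    NonTautological-resp-SameClause C≈D (NonTautological-intro noComplements)
  InPhi1⇒NonTautological (_ , _ , _ , _ , _ , _ , _ , noComplements , inj₂ C≈¬D) =
    NonTautological-resp-SameClause C≈¬D
      (NonTautological-negClause (NonTautological-intro noComplements))

  module Colouring {k : ℕ} (χ0 : Edge → Bool) (proper : ProperColouring χ0)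
                   (wd : WellDefinedColouring χ0) (comp : Edge → Fin k)
                   (lab : IsComponentLabelling k comp) where
    open Literals χ0 comp

    same-component⇒Conn : ∀ e f → comp e ≡ comp f → Conn e f
    same-component⇒Conn e f = Equivalence.to (proj₁ lab e f)

    ℓ-SameEdge : ∀ e f → SameEdge e f → ℓ e ≡ ℓ f
    ℓ-SameEdge e f s = cong₂ _,_ (Equivalence.from (proj₁ lab e f) (base s)) (wd e f s)

    ℓ-Conflict : ∀ e f → Conflict e f → ℓ f ≡ neg (ℓ e)
    ℓ-Conflict e f cf = cong₂ _,_ (sym same-component) (¬-not (≢-sym (proper e f cf)))
      where
        same-component : comp e ≡ comp f
        same-component =
          Equivalence.from (proj₁ lab e f) (step {f = e} (base (SameEdge-refl e)) cf)

    Adj-unless-Conflict : ∀ {a b c d} (p : Adj a b) (q : Adj c d) → Distinct4 a b c d → ¬ Adj b c →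
      ℓ (mkE c d q) ≢ neg (ℓ (mkE a b p)) → Adj a d
    Adj-unless-Conflict {a} {b} {c} {d} p q distinct ¬bc ℓ≢ =
      Adj-stable a d (λ ¬ad → ℓ≢ (ℓ-Conflict (mkE a b p) (mkE c d q) (inj₁ (distinct , ¬ad , ¬bc))))

    clause : ∀ {w1 w2 w3 w4 w5 w6} → AC6 w1 w2 w3 w4 w5 w6 → Clause k
    clause c = ℓ (edge23 c) , ℓ (edge45 c) , ℓ (edge61 c)

    AP6-flip : ∀ {w1 w2 w3 w4 w5 w6} (ap : AP6 w1 w2 w3 w4 w5 w6) →
      NonTautological (clause (AP6.cyc ap)) → ∀ g → Conflict (edge45 (AP6.cyc ap)) g →
      Σ Vtx λ α → Σ Vtx λ β → Σ (AP6 w2 w1 w4 α β w5) λ ap′ →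
        SameEdge (edge45 (AP6.cyc ap′)) g × clause (AP6.cyc ap′) ≡ negClause (clause (AP6.cyc ap))
    AP6-flip {w1} {w2} {w3} {w4} {w5} {w6}
             record { cyc = c ; distinct = D@(d12 , d13 , d14 , d15 , d16 , d23 , d24 , d25 , d26 ,
                                              d34 , d35 , _ , d45 , d46 , d56) }
             nt g cf
      with Conflict⇒oriented (AC6.e45 c) g cf
    ... | α , β , r , αβ≈g , (d4@(_ , _ , d4α , d5β , _ , _) , ¬4α , ¬5β) =
      α , β , record { cyc = c′ ; distinct = distinct′ } , αβ≈g ,
      cong₂ _,_ ℓ₁′ (cong₂ _,_ (trans (ℓ-SameEdge _ g αβ≈g) (ℓ-Conflict (edge45 c) g cf)) ℓ₃′)
      where
        open AC6 c
        a14 : Adj w1 w4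
        a14 = Adj-sym (Adj-unless-Conflict e45 e61
                        (d45 , d46 , ≢-sym d14 , d56 , ≢-sym d15 , ≢-sym d16)
                        (proj₂ n56) (nt (inj₂ (inj₂ refl)) (inj₂ (inj₁ refl))))
        a25 : Adj w2 w5
        a25 = Adj-unless-Conflict e23 e45 (d23 , d24 , d25 , d34 , d35 , d45)
                                  (proj₂ n34) (nt (inj₂ (inj₁ refl)) (inj₁ refl))
        c′ : AC6 w2 w1 w4 α β w5
        c′ = record { e23 = a14 ; e45 = r ; e61 = Adj-sym a25 ; n12 = NonEdge-sym n12
                    ; n34 = d4α , ¬4α ; n56 = NonEdge-sym (d5β , ¬5β) }
        d1α : w1 ≢ α
        d1α w1≡α = ¬4α (subst (Adj w4) w1≡α (Adj-sym a14))
        d2β : w2 ≢ β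
        d2β w2≡β = ¬5β (subst (Adj w5) w2≡β (Adj-sym a25))
        avoids : w2 ≢ α × w1 ≢ β
        avoids = swapped-ceiling-avoids-base c (d4α , ¬4α) r (d5β , ¬5β)
        distinct′ : AllDistinct6 w2 w1 w4 α β w5
        distinct′ = swapped-distinct D d4 d1α (proj₁ avoids) (proj₂ avoids) d2β
        ℓ₁′ : ℓ (mkE w1 w4 a14) ≡ neg (ℓ (edge23 c))
        ℓ₁′ = ℓ-Conflict (edge23 c) (mkE w1 w4 a14)
                (inj₂ (inj₁ ((d23 , d24 , ≢-sym d12 , d34 , ≢-sym d13 , ≢-sym d14) ,
                             proj₂ (NonEdge-sym n12) , proj₂ n34)))
        ℓ₃′ : ℓ (mkE w5 w2 (Adj-sym a25)) ≡ neg (ℓ (edge61 c))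
        ℓ₃′ = ℓ-Conflict (edge61 c) (mkE w5 w2 (Adj-sym a25))
                (inj₂ (inj₁ ((≢-sym d16 , ≢-sym d26 , ≢-sym d56 , d12 , d15 , d25) ,
                             proj₂ (NonEdge-sym n56) , proj₂ n12)))

    AP6-along-Conn : ∀ {v1 v2 v3 v4 v5 v6} (ap : AP6 v1 v2 v3 v4 v5 v6) →
      NonTautological (clause (AP6.cyc ap)) → ∀ {g} → Conn (edge45 (AP6.cyc ap)) g →
      Σ Vtx λ w1 → Σ Vtx λ w2 → Σ Vtx λ w3 → Σ Vtx λ w4 → Σ Vtx λ w5 → Σ Vtx λ w6 →
      Σ (AP6 w1 w2 w3 w4 w5 w6) λ ap′ →
        SamePair w1 w2 v1 v2 × SameEdge (edge45 (AP6.cyc ap′)) g ×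
        clause (AP6.cyc ap′) ≡± clause (AP6.cyc ap)
    AP6-along-Conn ap _ (base s) = _ , _ , _ , _ , _ , _ , ap , inj₁ (refl , refl) , s , inj₁ refl
    AP6-along-Conn ap nt (step {f = f} {g} conn cf) with AP6-along-Conn ap nt conn
    ... | w1 , w2 , _ , w4 , w5 , _ , ap′ , base′ , ceiling≈f , clause≡±
      with AP6-flip ap′ (NonTautological-resp-≡± clause≡± nt) g
             (SameEdge-conflict (edge45 (AP6.cyc ap′)) f g ceiling≈f cf)
    ... | α , β , ap″ , ceiling≈g , flipped =
      w2 , w1 , w4 , α , β , w5 , ap″ , SamePair-swap base′ , ceiling≈g ,
      ≡±-negClause flipped clause≡±

    AP6-with-ceiling : ∀ {v1 v2 v3 v4 v5 v6} (ap : AP6 v1 v2 v3 v4 v5 v6) →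
      NonTautological (clause (AP6.cyc ap)) → ∀ e → ℓ e ≡ ℓ (edge45 (AP6.cyc ap)) →
      Σ Vtx λ w1 → Σ Vtx λ w2 → Σ Vtx λ w3 → Σ Vtx λ w4 → Σ Vtx λ w5 → Σ Vtx λ w6 →
      Σ (AP6 w1 w2 w3 w4 w5 w6) λ ap′ →
        SamePair w1 w2 v1 v2 × SameEdge (edge45 (AP6.cyc ap′)) e ×
        clause (AP6.cyc ap′) ≡ clause (AP6.cyc ap)
    AP6-with-ceiling ap nt e ℓe≡ℓ₂
      with AP6-along-Conn ap nt (same-component⇒Conn _ e (sym (cong proj₁ ℓe≡ℓ₂)))
    ... | w1 , w2 , w3 , w4 , w5 , w6 , ap′ , base′ , ceiling≈e , inj₁ same-clause =
      w1 , w2 , w3 , w4 , w5 , w6 , ap′ , base′ , ceiling≈e , same-clause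
    ... | _ , _ , _ , _ , _ , _ , ap′ , _ , ceiling≈e , inj₂ negated-clause =
      ⊥-elim (l≢neg-l _ (begin
        ℓ (edge45 (AP6.cyc ap))       ≡⟨ sym ℓe≡ℓ₂ ⟩
        ℓ e                           ≡⟨ sym (ℓ-SameEdge _ e ceiling≈e) ⟩
        ℓ (edge45 (AP6.cyc ap′))      ≡⟨ cong (proj₁ ∘ proj₂) negated-clause ⟩
        neg (ℓ (edge45 (AP6.cyc ap))) ∎))
      where open ≡-Reasoning

lemma15 : {n : ℕ} (_<P_ : Rel (Fin n) 0ℓ) → IsStrictPartialOrder _≡_ _<P_ →
    let open Graph _<P_ in
    (k : ℕ) (χ0 : Edge → Bool) → ProperColouring χ0 → WellDefinedColouring χ0 →
    (comp : Edge → Fin k) → IsComponentLabelling k comp →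
    let open Literals χ0 comp in
    (v1 v2 v3 v4 v5 v6 : Vtx) (ap : AP6 v1 v2 v3 v4 v5 v6) →
    let c = AP6.cyc ap
        ℓ₁ = ℓ (edge23 c)
        ℓ₂ = ℓ (edge45 c)
        ℓ₃ = ℓ (edge61 c)
    in
    InPhi1 (ℓ₁ , ℓ₂ , ℓ₃) →
    (e : Edge) → ℓ e ≡ ℓ₂ →
    Σ Vtx λ w1 → Σ Vtx λ w2 → Σ Vtx λ w3 → Σ Vtx λ w4 → Σ Vtx λ w5 → Σ Vtx λ w6 →
    Σ (AP6 w1 w2 w3 w4 w5 w6) λ ap′ →
      ((w1 ≡ v1 × w2 ≡ v2) ⊎ (w1 ≡ v2 × w2 ≡ v1)) ×
      SameEdge (edge45 (AP6.cyc ap′)) e ×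
      ℓ (edge23 (AP6.cyc ap′)) ≡ ℓ₁ ×
      ℓ (edge45 (AP6.cyc ap′)) ≡ ℓ₂ ×
      ℓ (edge61 (AP6.cyc ap′)) ≡ ℓ₃
lemma15 _<P_ _ k χ0 proper wd comp lab v1 v2 v3 v4 v5 v6 ap φ₁-clause e ℓe≡ℓ₂ =
  let w1 , w2 , w3 , w4 , w5 , w6 , ap′ , base′ , ceiling≈e , same-clause =
        AP6-with-ceiling ap (InPhi1⇒NonTautological φ₁-clause) e ℓe≡ℓ₂
  in w1 , w2 , w3 , w4 , w5 , w6 , ap′ , base′ , ceiling≈e ,
     cong proj₁ same-clause , cong (proj₁ ∘ proj₂) same-clause , cong (proj₂ ∘ proj₂) same-clause
  where
    open Properties _<P_
    open Colouring χ0 proper wd comp lab
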